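{- Let $w\in\mathbb{YF}_\infty^+$ and $\epsilon>0$. Then there exist $N'\in\mathbb{N}_0$ and $\delta\in(0,1)$ such that for all $n\in\mathbb{N}_0$ with $n\ge N'$ and all $v\in P(w,n,\delta)$ we have $1-\epsilon<\dfrac{\pi(v)}{\pi(w)}$, where $P(w,n,\delta)=\{v\in\mathbb{YF}_n:\ h'(v,w)\ge(1-\delta)n\}$.
   Context: Words are finite words over $\{1,2\}$; $|x|$ is the digit sum and $d(x)$ the number of $2$'s of $x$. $\mathbb{YF}$ is the set of all finite words, $\mathbb{YF}_n=\{x:|x|=n\}$. $\mathbb{YF}_\infty$ is the set of left-infinite words $\dots\alpha_2\alpha_1$ over $\{1,2\}$. For $x$ finite or left-infinite and $1\le i\le d(x)$, $g(x,i)=1+$ (digit sum of the part of $x$ strictly to the right of the $i$-th letter $2$ of $x$, counting from the right). $\pi(x)=\prod_{i:\,g(x,i)>1}\frac{g(x,i)-1}{g(x,i)}$; $\mathbb{YF}_\infty^+=\{w\in\mathbb{YF}_\infty:\pi(w)>0\}$. $h'(x,y)$ is the digit sum of the longest common suffix of $x$ and $y$.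
   Formalization: The parameter ε ranges over the positive rationals instead of the positive reals, and the witness δ is taken in the rationals. -}

module Defs where

open import Data.Nat as ℕ using (ℕ; zero; suc; _+_)
open import Data.Integer using (+_)
open import Data.Rational using (ℚ; _/_; 1ℚ; _*_; _-_; _≤_; _<_; 0ℚ)
open import Data.List using (List; []; _∷_)
open import Data.Product using (Σ; _×_; ∃)
open import Relation.Binary.PropositionalEquality using (_≡_)

data Digit : Set where
  one two : Digit

val : Digit → ℕ
val one = 1
val two = 2

-- A finite word is a list of letters, STORED RIGHT-TO-LEFT:
-- the head of the list is the rightmost letter α₁.
Word : Set
Word = List Digit

-- A left-infinite word ...α₂α₁ : position i (from 0) holds α_{i+1}.
InfWord : Set
InfWord = ℕ → Digit

digitSum : Word → ℕ
digitSum [] = 0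
digitSum (d ∷ x) = val d + digitSum x

ℕtoℚ : ℕ → ℚ
ℕtoℚ n = + n / 1

-- factor contributed by a letter 2 with g = 1 + s (s = digit sum strictly
-- to its right): (g-1)/g if g > 1, and 1 (omitted) if g = 1.
factor : ℕ → ℚ
factor zero = 1ℚ
factor (suc s) = + (suc s) / suc (suc s)

-- π with accumulated digit sum s of the already-read (right) part
piAux : ℕ → Word → ℚ
piAux s [] = 1ℚ
piAux s (one ∷ x) = piAux (s + 1) x
piAux s (two ∷ x) = factor s * piAux (s + 2) x

π : Word → ℚ
π = piAux 0

suffix : InfWord → ℕ → Word
suffix w zero = []
suffix w (suc k) = w 0 ∷ suffix (λ i → w (suc i)) k

-- The k-th partial product of π(w): the product of the factors of the
-- 2's among α_k...α₁ (these g-values coincide with those in w).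
-- π(w) is the infimum (= limit) of these decreasing partial products.
πPartial : InfWord → ℕ → ℚ
πPartial w k = π (suffix w k)

-- w ∈ YF∞⁺ : π(w) > 0, i.e. the partial products have a positive
-- rational lower bound.
InYFInfPlus : InfWord → Set
InYFInfPlus w = ∃ λ (c : ℚ) → (0ℚ < c) × (∀ k → c ≤ πPartial w k)

h' : Word → InfWord → ℕ
h' [] w = 0
h' (d ∷ v) w = step d (w 0)
  where
  rest : ℕ
  rest = h' v (λ i → w (suc i))
  step : Digit → Digit → ℕ
  step one one = 1 + rest
  step two two = 2 + rest
  step _ _ = 0

InP : InfWord → ℕ → ℚ → Word → Set
InP w n δ v = (digitSum v ≡ n) × ((1ℚ - δ) * ℕtoℚ n ≤ ℕtoℚ (h' v w))

{-# OPTIONS --safe #-}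
-- The quantity π(x)·|x| never decreases when letters are added to the left of x: a letter 2
-- read at digit-sum offset s multiplies π by s/(s+1) and raises the offset to s + 2, and
-- s(s+2)/(s+1) ≥ s. The longest common suffix u of v and w is a suffix of w, so π(u) is a
-- partial product of π(w), and the monotonicity gives π(u)·h'(v,w) ≤ π(v)·n. With
-- h'(v,w) ≥ (1-δ)n and π(u) > 0 this yields π(v) ≥ (1-δ)π(u) > (1-ε)π(u) as soon as δ < ε.
module Submission where

open import Defs
open import Data.Nat using (ℕ; _≥_)
open import Data.Rational using (ℚ; 0ℚ; 1ℚ; _<_; _*_; _-_)
open import Data.Product using (∃; _×_)

open import Data.Nat as ℕ using (zero; suc; _+_)
import Data.Nat.Properties as ℕ
import Data.Integer as ℤ
import Data.Integer.Properties as ℤ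
open import Data.Rational using (_≤_; Positive; NonNegative; positive; fromℚᵘ; toℚᵘ)
open import Data.Rational.Properties
import Data.Rational.Unnormalised as ℚᵘ
import Data.Rational.Unnormalised.Properties as ℚᵘ
open import Data.List using ([]; _∷_; _++_)
open import Data.Product using (_,_)
open import Relation.Nullary using (yes; no)
open import Relation.Binary.PropositionalEquality

fromℚᵘ-mono-≤ : ∀ p q → p ℚᵘ.≤ q → fromℚᵘ p ≤ fromℚᵘ q
fromℚᵘ-mono-≤ p q p≤q = toℚᵘ-cancel-≤
  (ℚᵘ.≤-respˡ-≃ (ℚᵘ.≃-sym (toℚᵘ-fromℚᵘ p)) (ℚᵘ.≤-respʳ-≃ (ℚᵘ.≃-sym (toℚᵘ-fromℚᵘ q)) p≤q))

fromℚᵘ-homo-* : ∀ p q → fromℚᵘ p * fromℚᵘ q ≡ fromℚᵘ (p ℚᵘ.* q)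
fromℚᵘ-homo-* p q = toℚᵘ-injective (ℚᵘ.≃-trans (toℚᵘ-homo-* (fromℚᵘ p) (fromℚᵘ q))
  (ℚᵘ.≃-trans (ℚᵘ.*-cong (toℚᵘ-fromℚᵘ p) (toℚᵘ-fromℚᵘ q)) (ℚᵘ.≃-sym (toℚᵘ-fromℚᵘ (p ℚᵘ.* q)))))

-- ℕtoℚ n is definitionally fromℚᵘ (mkℚᵘ (+ n) 0), and factor (suc s) is fromℚᵘ (mkℚᵘ (+ suc s) (suc s)).
ℕtoℚ-mono-≤ : ∀ {m n} → m ℕ.≤ n → ℕtoℚ m ≤ ℕtoℚ n
ℕtoℚ-mono-≤ {m} {n} m≤n = fromℚᵘ-mono-≤ (ℚᵘ.mkℚᵘ (ℤ.+ m) 0) (ℚᵘ.mkℚᵘ (ℤ.+ n) 0) (ℚᵘ.*≤*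
  (subst₂ ℤ._≤_ (sym (ℤ.*-identityʳ (ℤ.+ m))) (sym (ℤ.*-identityʳ (ℤ.+ n))) (ℤ.+≤+ m≤n)))

letterFactor : Digit → ℕ → ℚ
letterFactor one s = 1ℚ
letterFactor two s = factor s

letterFactor-nonNeg : ∀ d s → NonNegative (letterFactor d s)
letterFactor-nonNeg one s = _
letterFactor-nonNeg two zero = _
letterFactor-nonNeg two (suc s) = normalize-nonNeg (suc s) (suc (suc s))

piAux-∷ : ∀ s d x → piAux s (d ∷ x) ≡ letterFactor d s * piAux (s + val d) x
piAux-∷ s one x = sym (*-identityˡ (piAux (s + 1) x))
piAux-∷ s two x = refl

ℕtoℚ≤letterFactor*ℕtoℚ : ∀ s d → ℕtoℚ s ≤ letterFactor d s * ℕtoℚ (s + val d)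
ℕtoℚ≤letterFactor*ℕtoℚ s one = subst (ℕtoℚ s ≤_) (sym (*-identityˡ _)) (ℕtoℚ-mono-≤ (ℕ.m≤m+n s 1))
ℕtoℚ≤letterFactor*ℕtoℚ zero two = ≤ᵇ⇒≤ _
ℕtoℚ≤letterFactor*ℕtoℚ s@(suc t) two =
  subst (ℕtoℚ s ≤_) (sym (fromℚᵘ-homo-* s/[s+1] s+2))
    (fromℚᵘ-mono-≤ (ℚᵘ.mkℚᵘ (ℤ.+ suc t) 0) (s/[s+1] ℚᵘ.* s+2) (ℚᵘ.*≤* (ℤ.+≤+ cross)))
  where
  s/[s+1] s+2 : ℚᵘ.ℚᵘ
  s/[s+1] = ℚᵘ.mkℚᵘ (ℤ.+ suc t) (suc t)
  s+2 = ℚᵘ.mkℚᵘ (ℤ.+ (suc t + 2)) 0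
  -- s·(s+1) ≤ s·(s+2), cross-multiplied
  cross : suc t ℕ.* suc (suc (t ℕ.* 1)) ℕ.≤ (suc t ℕ.* (suc t + 2)) ℕ.* 1
  cross rewrite ℕ.*-identityʳ t | ℕ.*-identityʳ (suc t ℕ.* (suc t + 2)) =
    ℕ.*-monoʳ-≤ (suc t) (ℕ.≤-trans (ℕ.n≤1+n _) (ℕ.≤-reflexive (cong suc (ℕ.+-comm 2 t))))

weight : ℕ → Word → ℚ
weight s x = piAux s x * ℕtoℚ (s + digitSum x)

weight-[] : ∀ s → weight s [] ≡ ℕtoℚ s
weight-[] s = trans (*-identityˡ _) (cong ℕtoℚ (ℕ.+-identityʳ s))

weight-∷ : ∀ s d x → weight s (d ∷ x) ≡ letterFactor d s * weight (s + val d) x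
weight-∷ s d x = begin
  piAux s (d ∷ x) * ℕtoℚ (s + (val d + digitSum x))
    ≡⟨ cong₂ _*_ (piAux-∷ s d x) (cong ℕtoℚ (sym (ℕ.+-assoc s (val d) (digitSum x)))) ⟩
  letterFactor d s * piAux (s + val d) x * ℕtoℚ (s + val d + digitSum x)
    ≡⟨ *-assoc (letterFactor d s) _ _ ⟩
  letterFactor d s * weight (s + val d) x ∎
  where open ≡-Reasoning

weight-∷-mono : ∀ s d {x y} → weight (s + val d) x ≤ weight (s + val d) y → weight s (d ∷ x) ≤ weight s (d ∷ y)
weight-∷-mono s d {x} {y} x≤y = subst₂ _≤_ (sym (weight-∷ s d x)) (sym (weight-∷ s d y))
  (*-monoˡ-≤-nonNeg (letterFactor d s) {{letterFactor-nonNeg d s}} x≤y)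

weight-[]-minimal : ∀ s y → weight s [] ≤ weight s y
weight-[]-minimal s [] = ≤-refl
weight-[]-minimal s (d ∷ y) = begin
  weight s []                               ≡⟨ weight-[] s ⟩
  ℕtoℚ s                                    ≤⟨ ℕtoℚ≤letterFactor*ℕtoℚ s d ⟩
  letterFactor d s * ℕtoℚ (s + val d)       ≡⟨ cong (letterFactor d s *_) (sym (weight-[] (s + val d))) ⟩
  letterFactor d s * weight (s + val d) []  ≡⟨ sym (weight-∷ s d []) ⟩
  weight s (d ∷ [])                         ≤⟨ weight-∷-mono s d (weight-[]-minimal (s + val d) y) ⟩
  weight s (d ∷ y)                          ∎
  where open ≤-Reasoning

weight-mono-++ : ∀ s u y → weight s u ≤ weight s (u ++ y)
weight-mono-++ s [] y = weight-[]-minimal s y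
weight-mono-++ s (d ∷ u) y = weight-∷-mono s d (weight-mono-++ (s + val d) u y)

common-suffix-split : ∀ v (w : InfWord) →
  ∃ λ k → ∃ λ y → v ≡ suffix w k ++ y × digitSum (suffix w k) ≡ h' v w
common-suffix-split [] w = 0 , [] , refl , refl
common-suffix-split (d ∷ v) w with d | w 0 in w₀≡ | common-suffix-split v (λ i → w (suc i))
... | one | two | _ = 0 , one ∷ v , refl , refl
... | two | one | _ = 0 , two ∷ v , refl , refl
... | one | one | k , y , v≡ , sum≡ = suc k , y , cong₂ _∷_ (sym w₀≡) v≡ , cong₂ _+_ (cong val w₀≡) sum≡
... | two | two | k , y , v≡ , sum≡ = suc k , y , cong₂ _∷_ (sym w₀≡) v≡ , cong₂ _+_ (cong val w₀≡) sum≡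

πPartial*h'≤π*digitSum : ∀ v w → ∃ λ k → πPartial w k * ℕtoℚ (h' v w) ≤ π v * ℕtoℚ (digitSum v)
πPartial*h'≤π*digitSum v w with common-suffix-split v w
... | k , y , refl , sum≡ =
  k , subst (λ m → πPartial w k * ℕtoℚ m ≤ weight 0 (suffix w k ++ y)) sum≡ (weight-mono-++ 0 (suffix w k) y)

ratio-bound : ∀ p n {q h δ ε} .{{_ : Positive p}} .{{_ : Positive n}} → δ < ε →
  (1ℚ - δ) * n ≤ h → p * h ≤ q * n → (1ℚ - ε) * p < q
ratio-bound p n {q} {h} {δ} {ε} δ<ε [1-δ]n≤h ph≤qn = begin-strict
  (1ℚ - ε) * p  <⟨ *-monoˡ-<-pos p (+-monoʳ-< 1ℚ (neg-antimono-< δ<ε)) ⟩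
  (1ℚ - δ) * p  ≡⟨ *-comm (1ℚ - δ) p ⟩
  p * (1ℚ - δ)  ≤⟨ *-cancelʳ-≤-pos n p[1-δ]n≤qn ⟩
  q             ∎
  where
  open ≤-Reasoning
  p[1-δ]n≤qn : p * (1ℚ - δ) * n ≤ q * n
  p[1-δ]n≤qn = ≤-trans (≤-reflexive (*-assoc p (1ℚ - δ) n))
    (≤-trans (*-monoˡ-≤-nonNeg p {{pos⇒nonNeg p}} [1-δ]n≤h) ph≤qn)

∃-positive-below-1-and : ∀ {ε} → 0ℚ < ε → ∃ λ δ → (0ℚ < δ) × (δ < 1ℚ) × (δ < ε)
∃-positive-below-1-and {ε} 0<ε with ε ≤? 1ℚ
... | yes ε≤1 = let (δ , 0<δ , δ<ε) = <-dense 0<ε in δ , 0<δ , <-≤-trans δ<ε ε≤1 , δ<ε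
... | no ε≰1 = let (δ , 0<δ , δ<1) = <-dense (positive⁻¹ 1ℚ) in δ , 0<δ , δ<1 , <-trans δ<1 (≰⇒> ε≰1)

mainTheorem17 : (w : InfWord) → InYFInfPlus w → (ε : ℚ) → 0ℚ < ε →
    ∃ λ (N' : ℕ) → ∃ λ (δ : ℚ) → (0ℚ < δ) × (δ < 1ℚ) ×
    (∀ (n : ℕ) → n ≥ N' → ∀ (v : Word) → InP w n δ v →
    ∃ λ (k : ℕ) → (1ℚ - ε) * πPartial w k < π v)
mainTheorem17 w (c , 0<c , c≤πPartial) ε 0<ε with ∃-positive-below-1-and 0<ε
... | δ , 0<δ , δ<1 , δ<ε = 1 , δ , 0<δ , δ<1 , bound
  where
  bound : ∀ n → n ≥ 1 → ∀ v → InP w n δ v → ∃ λ k → (1ℚ - ε) * πPartial w k < π v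
  bound n@(suc _) _ v (digitSum≡n , h'-large) with πPartial*h'≤π*digitSum v w
  ... | k , πh'≤π|v| rewrite digitSum≡n =
    k , ratio-bound (πPartial w k) (ℕtoℚ n) {{positive (<-≤-trans 0<c (c≤πPartial k))}} {{normalize-pos n 1}}
          δ<ε h'-large πh'≤π|v|
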